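{- Let $T_1,T_2$ be anchored trees on the node set $[2n]$, i.e. both have the same root $r$ and in both trees the nodes $n+1,n+2,\ldots,2n$ are leaves attached to $r$. Then $\tilde d(T_1,T_2)=d(T_1,T_2)$.
   Context: Nodes of trees/forests are labelled by distinct labels and identified with them; $p_F(u)$ is the parent of $u$ in forest $F$, $\bot$ if $u$ is a root. Operations: (link-and-cut) given $u,v,w$ with $v$ a child of $u$ and $w$ not a descendant of $v$, $v\,|\,u\to w$ removes edge $(v,u)$ and makes $v$ a child of $w$; (cut) given $v$ a child of $u$, $(v\dagger u)$ removes the edge $(v,u)$, making $v$ a root; (permutation) apply a permutation $\pi$ of the labels, so $\pi(u)$ becomes a child of $\pi(v)$ whenever $u$ was a child of $v$. The size of a sequence of operations is the number of link-and-cut/cut operations plus the sum over permutations $\pi$ of $|\{x:\pi(x)\neq x\}|$. For trees $T_1,T_2$ with identical roots, $d(T_1,T_2)$ is the minimum size of a sequence of link-and-cut and permutation operations transforming $T_1$ into $T_2$ without permuting the root. For forests, write $F_1\sim F_2$ if for every node $u$ at least one of: $p_{F_1}(u)=p_{F_2}(u)$, $p_{F_1}(u)=\bot$, $p_{F_2}(u)=\bot$. Then $\tilde d(F_1,F_2)$ is the minimum size of a sequence of cut and permutation operations transforming $F_1$ into some $F_1'$ with $F_1'\sim F_2$. -}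

module Defs where

open import Data.Nat using (ℕ; zero; suc; _+_; _*_; _≤_)
open import Data.Fin using (Fin; _≟_; toℕ)
open import Data.Fin.Permutation using (Permutation′; _⟨$⟩ʳ_; _⟨$⟩ˡ_)
open import Data.Maybe using (Maybe; just; nothing; map; _>>=_)
open import Data.List using (List; length; filter; allFin)
open import Data.Product using (Σ; _×_; _,_; ∃)
open import Relation.Nullary using (¬_)
open import Relation.Nullary.Decidable using (¬?)
open import Relation.Binary.PropositionalEquality using (_≡_; _≢_)

-- A (raw) forest on the label set Fin m, given by its parent function.
-- nothing plays the role of ⊥ (u is a root).
Parent : ℕ → Set
Parent m = Fin m → Maybe (Fin m)

anc : ∀ {m} → Parent m → ℕ → Fin m → Maybe (Fin m)
anc p zero    u = just u
anc p (suc k) u = anc p k u >>= p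

-- Acyclicity: following parents from any node reaches ⊥ within m steps.
IsForest : ∀ {m} → Parent m → Set
IsForest {m} p = ∀ u → anc p m u ≡ nothing

IsTreeRootedAt : ∀ {m} → Parent m → Fin m → Set
IsTreeRootedAt p r = IsForest p × p r ≡ nothing × (∀ u → p u ≡ nothing → u ≡ r)

-- w is a descendant of v (reflexively: v is a descendant of itself).
Descendant : ∀ {m} → Parent m → Fin m → Fin m → Set
Descendant p w v = ∃ λ k → anc p k w ≡ just v

_≐_ : ∀ {m} → Parent m → Parent m → Set
p ≐ q = ∀ u → p u ≡ q u

_∼_ : ∀ {m} → Parent m → Parent m → Set
p ∼ q = ∀ u → p u ≡ q u ⊎′ (p u ≡ nothing ⊎′ q u ≡ nothing)
  where
  open import Data.Sum using () renaming (_⊎_ to _⊎′_)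

support : ∀ {m} → Permutation′ m → ℕ
support {m} π = length (filter (λ x → ¬? ((π ⟨$⟩ʳ x) ≟ x)) (allFin m))

linkCut : ∀ {m} → Parent m → Fin m → Fin m → Parent m
linkCut p v w x with x ≟ v
... | Relation.Nullary.yes _ = just w
... | Relation.Nullary.no  _ = p x

cut : ∀ {m} → Parent m → Fin m → Parent m
cut p v x with x ≟ v
... | Relation.Nullary.yes _ = nothing
... | Relation.Nullary.no  _ = p x

-- permutation π : π(u) becomes a child of π(v) whenever u was a child of v
permute : ∀ {m} → Permutation′ m → Parent m → Parent m
permute π p y = map (π ⟨$⟩ʳ_) (p (π ⟨$⟩ˡ y))

data LCRun {m} (r : Fin m) : Parent m → Parent m → ℕ → Set where
  done : ∀ {F} → LCRun r F F 0
  lc   : ∀ {F G k} (u v w : Fin m) → F v ≡ just u → ¬ Descendant F w v →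
         LCRun r (linkCut F v w) G k → LCRun r F G (suc k)
  perm : ∀ {F G k} (π : Permutation′ m) → π ⟨$⟩ʳ r ≡ r →
         LCRun r (permute π F) G k → LCRun r F G (support π + k)

data CutRun {m} : Parent m → Parent m → ℕ → Set where
  done : ∀ {F} → CutRun F F 0
  ct   : ∀ {F G k} (u v : Fin m) → F v ≡ just u →
         CutRun (cut F v) G k → CutRun F G (suc k)
  perm : ∀ {F G k} (π : Permutation′ m) →
         CutRun (permute π F) G k → CutRun F G (support π + k)

-- "d(T1,T2) ≤ k" (root r fixed)
dAtMost : ∀ {m} → Fin m → Parent m → Parent m → ℕ → Set
dAtMost r T₁ T₂ k = ∃ λ j → ∃ λ G → LCRun r T₁ G j × G ≐ T₂ × j ≤ k

-- "d̃(F1,F2) ≤ k"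
d̃AtMost : ∀ {m} → Parent m → Parent m → ℕ → Set
d̃AtMost F₁ F₂ k = ∃ λ j → ∃ λ G → CutRun F₁ G j × G ∼ F₂ × j ≤ k

-- Anchored tree on [2n] (label i+1 represented by Fin index i):
-- a tree rooted at r in which the nodes n+1,…,2n (indices n,…,2n-1)
-- are leaves attached to r.
IsLeaf : ∀ {m} → Parent m → Fin m → Set
IsLeaf p u = ∀ x → p x ≢ just u

Anchored : (n : ℕ) → Parent (n + n) → Fin (n + n) → Set
Anchored n p r = IsTreeRootedAt p r ×
  (∀ (u : Fin (n + n)) → n ≤ toℕ u → IsLeaf p u × p u ≡ just r)

module Submission where

-- d̃ ≤ d holds for arbitrary forests: replaying a link-and-cut run with every
-- link-and-cut v|u→w replaced by the cut (v†u) (or skipped when v is already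
-- a root) keeps the cut forest a subforest of the linked one, hence ∼-related.
--
-- For d ≤ d̃ two discrepancy measures are compared: `mismatch S T` counts the
-- nodes whose parents in S and T differ, `conflict S T` only those where both
-- parents exist and differ.
--  * Normalisation: a cut run of size j ending ∼ T yields one permutation σ
--    with  support σ + conflict (σ·T₁) T ≤ j  (each cut removes one conflict).
--  * Greedy repair: if S and a tree T have the same unique root, then
--    d(S,T) ≤ mismatch S T; relink a wrong node whose T-parent is "settled"
--    (its whole T-path to the root is already correct), which creates no cycle.
-- If σ fixes the root r, then mismatch (σ·T₁) T₂ ≤ conflict, and d ≤ j.  If σ
-- moves r, every anchored leaf costs one unit, so j ≥ n ≥ mismatch T₁ T₂.

open import Defs
open import Data.Empty using (⊥-elim)
open import Data.Fin using (Fin; zero; suc; toℕ; _≟_; _↑ˡ_; _↑ʳ_; punchIn)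
open import Data.Fin.Permutation
  using (Permutation′; _⟨$⟩ʳ_; _⟨$⟩ˡ_; _∘ₚ_; inverseˡ; inverseʳ)
  renaming (id to idₚ)
open import Data.Fin.Properties using (all?; ¬∀⟶∃¬; punchInᵢ≢i; toℕ-↑ʳ)
open import Data.List using (length; filter; tabulate)
open import Data.Maybe using (Maybe; just; nothing; map; _>>=_)
open import Data.Maybe.Properties using (map-id; map-∘; map-nothing)
  renaming (≡-dec to ≡-decₘ)
open import Data.Nat using (ℕ; zero; suc; _+_; _*_; _≤_; _<_; z≤n; s≤s)
open import Data.Nat.Properties
  using ( +-0-commutativeMonoid; +-commutativeSemigroup; +-assoc; +-comm
        ; +-suc; +-identityʳ; *-suc; ≤-refl; ≤-reflexive; ≤-trans; ≤-pred
        ; +-mono-≤; +-monoˡ-≤; +-monoʳ-≤; m≤m+n; m≤n+m; m≤n⇒m≤1+n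
        ; module ≤-Reasoning)
open import Algebra.Properties.CommutativeMonoid.Sum +-0-commutativeMonoid
  using (sum; sum-cong-≗; sum-remove; sum-permute; ∑-distrib-+)
open import Algebra.Properties.CommutativeSemigroup +-commutativeSemigroup
  using (x∙yz≈y∙xz)
open import Data.Product using (∃; _×_; _,_; proj₁; proj₂)
open import Data.Sum using (_⊎_; inj₁; inj₂)
open import Function using (_∘_; case_of_)
open import Function.Bundles using (_⇔_; mk⇔)
open import Relation.Binary.Definitions using (DecidableEquality)
open import Relation.Binary.PropositionalEquality
open import Relation.Nullary using (¬_; Dec; yes; no; ¬?)
open import Relation.Unary using (Pred; Decidable)

fails : ∀ {a} {A : Set a} → Dec A → ℕ
fails (yes _) = 0
fails (no _)  = 1

fails≤1 : ∀ {a} {A : Set a} (d : Dec A) → fails d ≤ 1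
fails≤1 (yes _) = z≤n
fails≤1 (no _)  = s≤s z≤n

fails-true : ∀ {a} {A : Set a} → A → (d : Dec A) → fails d ≡ 0
fails-true _ (yes _)  = refl
fails-true a (no ¬a) = ⊥-elim (¬a a)

fails-false : ∀ {a} {A : Set a} → ¬ A → (d : Dec A) → fails d ≡ 1
fails-false ¬a (yes a) = ⊥-elim (¬a a)
fails-false _  (no _)  = refl

sum-mono : ∀ {m} {f g : Fin m → ℕ} → (∀ x → f x ≤ g x) → sum f ≤ sum g
sum-mono {zero}  _   = z≤n
sum-mono {suc m} f≤g = +-mono-≤ (f≤g zero) (sum-mono (f≤g ∘ suc))

sum-zero : ∀ {m} {f : Fin m → ℕ} → (∀ x → f x ≡ 0) → sum f ≡ 0
sum-zero {zero}  _    = refl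
sum-zero {suc m} f≡0 = cong₂ _+_ (f≡0 zero) (sum-zero (f≡0 ∘ suc))

sum-ones : ∀ m → sum {m} (λ _ → 1) ≡ m
sum-ones zero    = refl
sum-ones (suc m) = cong suc (sum-ones m)

sum-split : ∀ a {b} (f : Fin (a + b) → ℕ) →
            sum f ≡ sum (λ i → f (i ↑ˡ b)) + sum (λ i → f (a ↑ʳ i))
sum-split zero    f = refl
sum-split (suc a) f =
  trans (cong (f zero +_) (sum-split a (f ∘ suc))) (sym (+-assoc (f zero) _ _))

↑ʳ-beyond : ∀ a {b} (i : Fin b) → a ≤ toℕ (a ↑ʳ i)
↑ʳ-beyond a i = subst (a ≤_) (sym (toℕ-↑ʳ a i)) (m≤m+n a (toℕ i))

sum-bound-first : ∀ a {b} {f : Fin (a + b) → ℕ} →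
                  (∀ x → f x ≤ 1) → (∀ x → a ≤ toℕ x → f x ≡ 0) → sum f ≤ a
sum-bound-first a {b} {f} f≤1 vanish = begin
  sum f                                                ≡⟨ sum-split a f ⟩
  sum (λ i → f (i ↑ˡ b)) + sum (λ i → f (a ↑ʳ i))     ≤⟨ +-mono-≤ (sum-mono (f≤1 ∘ (_↑ˡ b))) (≤-reflexive tail≡0) ⟩
  sum {a} (λ _ → 1) + 0                                ≡⟨ trans (+-identityʳ _) (sum-ones a) ⟩
  a                                                    ∎
  where
  open ≤-Reasoning
  tail≡0 : sum (λ i → f (a ↑ʳ i)) ≡ 0
  tail≡0 = sum-zero (λ i → vanish _ (↑ʳ-beyond a i))

sum-bound-last : ∀ a {b} {f : Fin (a + b) → ℕ} → (∀ x → a ≤ toℕ x → 1 ≤ f x) → b ≤ sum f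
sum-bound-last a {b} {f} positive = begin
  b                                                    ≡⟨ sum-ones b ⟨
  sum {b} (λ _ → 1)                                    ≤⟨ sum-mono (λ i → positive _ (↑ʳ-beyond a i)) ⟩
  sum (λ i → f (a ↑ʳ i))                               ≤⟨ m≤n+m _ _ ⟩
  sum (λ i → f (i ↑ˡ b)) + sum (λ i → f (a ↑ʳ i))     ≡⟨ sum-split a f ⟨
  sum f                                                ∎
  where open ≤-Reasoning

sum-exchange : ∀ {m} {f g : Fin m → ℕ} (v : Fin m) →
               (∀ x → x ≢ v → f x ≤ g x) → g v + sum f ≤ f v + sum g
sum-exchange {suc m} {f} {g} v f≤g = begin
  g v + sum f                  ≡⟨ cong (g v +_) (sum-remove {i = v} f) ⟩
  g v + (f v + rest f)         ≡⟨ x∙yz≈y∙xz (g v) (f v) (rest f) ⟩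
  f v + (g v + rest f)         ≤⟨ +-monoʳ-≤ (f v) (+-monoʳ-≤ (g v) rest≤) ⟩
  f v + (g v + rest g)         ≡⟨ cong (f v +_) (sum-remove {i = v} g) ⟨
  f v + sum g                  ∎
  where
  open ≤-Reasoning
  rest : (Fin (suc m) → ℕ) → ℕ
  rest h = sum (h ∘ punchIn v)
  rest≤ : rest f ≤ rest g
  rest≤ = sum-mono (λ j → f≤g (punchIn v j) (punchInᵢ≢i v j))

support-sum : ∀ {m} (σ : Permutation′ m) → support σ ≡ sum (λ x → fails ((σ ⟨$⟩ʳ x) ≟ x))
support-sum σ = count-rejected (λ x → (σ ⟨$⟩ʳ x) ≟ x) (λ x → x)
  where
  count-rejected : ∀ {a p} {A : Set a} {P : Pred A p} (P? : Decidable P) {k} (f : Fin k → A) →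
                   length (filter (¬? ∘ P?) (tabulate f)) ≡ sum (λ i → fails (P? (f i)))
  count-rejected P? {zero}  f = refl
  count-rejected P? {suc k} f with P? (f zero)
  ... | yes _ = count-rejected P? (f ∘ suc)
  ... | no _  = cong suc (count-rejected P? (f ∘ suc))

support-id : ∀ {m} → support (idₚ {m}) ≡ 0
support-id {m} = trans (support-sum {m} idₚ) (sum-zero {m} (λ x → fails-true refl (x ≟ x)))

-- Every point moved by π ∘ₚ σ is moved by π or by σ.
support-∘ : ∀ {m} (π σ : Permutation′ m) → support (π ∘ₚ σ) ≤ support π + support σ
support-∘ π σ = begin
  support (π ∘ₚ σ)                          ≡⟨ support-sum (π ∘ₚ σ) ⟩
  sum (λ x → fails (σπ x ≟ x))              ≤⟨ sum-mono moved ⟩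
  sum (λ x → fails (πʳ x ≟ x) + fails (σπ x ≟ πʳ x))
                                            ≡⟨ ∑-distrib-+ (λ x → fails (πʳ x ≟ x)) (λ x → fails (σπ x ≟ πʳ x)) ⟩
  sum (λ x → fails (πʳ x ≟ x)) + sum (λ x → fails (σπ x ≟ πʳ x))
                                            ≡⟨ cong₂ _+_ (support-sum π) (trans (support-sum σ) (sum-permute _ π)) ⟨
  support π + support σ                     ∎
  where
  open ≤-Reasoning
  πʳ = π ⟨$⟩ʳ_
  σπ = λ x → σ ⟨$⟩ʳ (π ⟨$⟩ʳ x)
  moved : ∀ x → fails (σπ x ≟ x) ≤ fails (πʳ x ≟ x) + fails (σπ x ≟ πʳ x)
  moved x with πʳ x ≟ x
  ... | yes πx≡x rewrite πx≡x = ≤-refl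
  ... | no _     = ≤-trans (fails≤1 _) (m≤m+n 1 _)

>>=-assoc : ∀ {A B C : Set} (x : Maybe A) (f : A → Maybe B) (g : B → Maybe C) →
            ((x >>= f) >>= g) ≡ (x >>= λ y → f y >>= g)
>>=-assoc nothing  f g = refl
>>=-assoc (just x) f g = refl

>>=-just : ∀ {A : Set} (x : Maybe A) → (x >>= just) ≡ x
>>=-just nothing  = refl
>>=-just (just x) = refl

anc-+ : ∀ {m} (p : Parent m) k a u → anc p (k + a) u ≡ (anc p a u >>= anc p k)
anc-+ p zero    a u = sym (>>=-just (anc p a u))
anc-+ p (suc k) a u =
  trans (cong (_>>= p) (anc-+ p k a u)) (>>=-assoc (anc p a u) (anc p k) p)

anc-suc : ∀ {m} (p : Parent m) k u → anc p (suc k) u ≡ (p u >>= anc p k)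
anc-suc p k u = trans (cong (λ i → anc p i u) (+-comm 1 k)) (anc-+ p k 1 u)

anc-beyond : ∀ {m} (p : Parent m) k a u → anc p a u ≡ nothing → anc p (k + a) u ≡ nothing
anc-beyond p k a u gone = trans (anc-+ p k a u) (cong (_>>= anc p k) gone)

acyclic : ∀ {m} {p : Parent m} → IsForest p → ∀ k v → anc p (suc k) v ≢ just v
acyclic {m} {p} forest k v cycle = case trans (sym (around m)) beyond of λ ()
  where
  around : ∀ i → anc p (i * suc k) v ≡ just v
  around zero    = refl
  around (suc i) = trans (anc-+ p (suc k) (i * suc k) v)
                         (trans (cong (_>>= anc p (suc k)) (around i)) cycle)
  beyond : anc p (m * suc k) v ≡ nothing
  beyond = trans (cong (λ i → anc p i v) (trans (*-suc m k) (+-comm m (m * k))))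
                 (anc-beyond p (m * k) m v (forest v))

descendant-cases : ∀ {m} {p : Parent m} {u y} → Descendant p u y →
                   y ≡ u ⊎ ∃ λ u′ → p u ≡ just u′ × Descendant p u′ y
descendant-cases (zero , refl) = inj₁ refl
descendant-cases {p = p} {u} (suc k , e) with p u | anc-suc p k u
... | just u′ | step = inj₂ (u′ , refl , k , trans (sym step) e)
... | nothing | step = case trans (sym step) e of λ ()

descendant-parent : ∀ {m} {p : Parent m} {u u′ y} → p u ≡ just u′ →
                    Descendant p u′ y → Descendant p u y
descendant-parent {p = p} {u} pu (k , e) =
  suc k , trans (anc-suc p k u) (trans (cong (_>>= anc p k) pu) e)

parent-fuel : ∀ {m} {p : Parent m} {u u′} f → p u ≡ just u′ →
              anc p (suc f) u ≡ nothing → anc p f u′ ≡ nothing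
parent-fuel {p = p} {u} f pu gone =
  trans (cong (_>>= anc p f) (sym pu)) (trans (sym (anc-suc p f u)) gone)

ancestor-fuel : ∀ {m} {p : Parent m} {u y} f → Descendant p u y →
                anc p f u ≡ nothing → anc p f y ≡ nothing
ancestor-fuel {p = p} {u} {y} f (k , e) gone = begin
  anc p f y                 ≡⟨ cong (_>>= anc p f) e ⟨
  (anc p k u >>= anc p f)   ≡⟨ anc-+ p f k u ⟨
  anc p (f + k) u           ≡⟨ cong (λ i → anc p i u) (+-comm f k) ⟩
  anc p (k + f) u           ≡⟨ anc-beyond p k f u gone ⟩
  nothing                   ∎
  where open ≡-Reasoning

ancestor-search : ∀ {m ℓ} {p : Parent m} {P : Pred (Fin m) ℓ} → Decidable P →
                  ∀ f u → anc p f u ≡ nothing →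
                  (∀ y → Descendant p u y → P y) ⊎ ∃ λ y → Descendant p u y × ¬ P y
ancestor-search P? zero u ()
ancestor-search {p = p} {P} P? (suc f) u gone with P? u
... | no ¬Pu = inj₂ (u , (0 , refl) , ¬Pu)
... | yes Pu with p u in pu
...   | nothing = inj₁ only-u
  where
  only-u : ∀ y → Descendant p u y → P y
  only-u y d with descendant-cases d
  ... | inj₁ refl          = Pu
  ... | inj₂ (_ , pu′ , _) = case trans (sym pu) pu′ of λ ()
...   | just u′ with ancestor-search P? f u′ (parent-fuel f pu gone)
...     | inj₂ (y , d , ¬Py) = inj₂ (y , descendant-parent pu d , ¬Py)
...     | inj₁ above = inj₁ all-above
  where
  all-above : ∀ y → Descendant p u y → P y
  all-above y d with descendant-cases d
  ... | inj₁ refl           = Pu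
  ... | inj₂ (_ , pu′ , d′) with trans (sym pu) pu′
  ...   | refl = above y d′

RootedAt : ∀ {m} → Parent m → Fin m → Set
RootedAt S r = S r ≡ nothing × (∀ u → S u ≡ nothing → u ≡ r)

roots-agree : ∀ {m} {S T : Parent m} {r} → RootedAt S r → RootedAt T r →
              ∀ x → S x ≡ nothing → T x ≡ nothing
roots-agree {T = T} (_ , onlyS) (Tr , _) x Sx = subst (λ y → T y ≡ nothing) (sym (onlyS x Sx)) Tr

non-root-parent : ∀ {m} {S : Parent m} {r v} → RootedAt S r → v ≢ r → ∃ λ u → S v ≡ just u
non-root-parent {S = S} {v = v} (_ , onlyS) v≢r with S v in Sv
... | just u  = u , refl
... | nothing = ⊥-elim (v≢r (onlyS v Sv))

permute-rootedAt : ∀ {m} {S : Parent m} {r} (σ : Permutation′ m) →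
                   RootedAt S r → RootedAt (permute σ S) (σ ⟨$⟩ʳ r)
permute-rootedAt {S = S} {r} σ (Sr , onlyS) =
  map-nothing (trans (cong S (inverseˡ σ)) Sr) , onlyσS
  where
  onlyσS : ∀ u → permute σ S u ≡ nothing → u ≡ σ ⟨$⟩ʳ r
  onlyσS u σSu with S (σ ⟨$⟩ˡ u) in Su
  ... | nothing = trans (sym (inverseʳ σ)) (cong (σ ⟨$⟩ʳ_) (onlyS _ Su))
  ... | just _  = case σSu of λ ()

permute-id : ∀ {m} (C : Parent m) → permute idₚ C ≐ C
permute-id C x = map-id (C x)

permute-∘ : ∀ {m} (π σ : Permutation′ m) (C : Parent m) →
            permute (π ∘ₚ σ) C ≐ permute σ (permute π C)
permute-∘ π σ C x = map-∘ (C (π ⟨$⟩ˡ (σ ⟨$⟩ˡ x)))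

linkCut-self : ∀ {m} (S : Parent m) v w → linkCut S v w v ≡ just w
linkCut-self S v w with v ≟ v
... | yes _  = refl
... | no v≢v = ⊥-elim (v≢v refl)

linkCut-other : ∀ {m} (S : Parent m) {v w x} → x ≢ v → linkCut S v w x ≡ S x
linkCut-other S {v} {x = x} x≢v with x ≟ v
... | yes x≡v = ⊥-elim (x≢v x≡v)
... | no _    = refl

cut-other : ∀ {m} (S : Parent m) {v x} → x ≢ v → cut S v x ≡ S x
cut-other S {v} {x} x≢v with x ≟ v
... | yes x≡v = ⊥-elim (x≢v x≡v)
... | no _    = refl

linkCut-rootedAt : ∀ {m} {S : Parent m} {r v} w → RootedAt S r → v ≢ r →
                   RootedAt (linkCut S v w) r
linkCut-rootedAt {S = S} {r} {v} w (Sr , onlyS) v≢r =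
  trans (linkCut-other S (v≢r ∘ sym)) Sr , only
  where
  only : ∀ u → linkCut S v w u ≡ nothing → u ≡ r
  only u gone with u ≟ v
  ... | yes refl = case gone of λ ()
  ... | no _     = onlyS u gone

_≟ₘ_ : ∀ {m} → DecidableEquality (Maybe (Fin m))
_≟ₘ_ = ≡-decₘ _≟_

mismatch : ∀ {m} → Parent m → Parent m → ℕ
mismatch S T = sum (λ x → fails (S x ≟ₘ T x))

clash : ∀ {m} → Maybe (Fin m) → Maybe (Fin m) → ℕ
clash (just a) (just b) = fails (a ≟ b)
clash _        _        = 0

conflict : ∀ {m} → Parent m → Parent m → ℕ
conflict S T = sum (λ x → clash (S x) (T x))

clash≤1 : ∀ {m} (a b : Maybe (Fin m)) → clash a b ≤ 1
clash≤1 (just a) (just b) = fails≤1 (a ≟ b)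
clash≤1 (just _) nothing  = z≤n
clash≤1 nothing  _        = z≤n

conflict-cong : ∀ {m} {S S′ : Parent m} (T : Parent m) → S ≐ S′ → conflict S T ≡ conflict S′ T
conflict-cong T S≐S′ = sum-cong-≗ (λ x → cong (λ a → clash a (T x)) (S≐S′ x))

conflict-∼ : ∀ {m} {S T : Parent m} → S ∼ T → conflict S T ≡ 0
conflict-∼ {S = S} {T} S∼T = sum-zero (λ x → compatible (S x) (T x) (S∼T x))
  where
  compatible : ∀ a b → a ≡ b ⊎ (a ≡ nothing ⊎ b ≡ nothing) → clash a b ≡ 0
  compatible (just a) (just .a) (inj₁ refl) = fails-true refl (a ≟ a)
  compatible nothing  _         _           = refl
  compatible (just _) nothing   _           = refl
  compatible (just _) (just _)  (inj₂ (inj₁ ()))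
  compatible (just _) (just _)  (inj₂ (inj₂ ()))

conflict-one-node : ∀ {m} {S S′ T : Parent m} v → (∀ x → x ≢ v → S x ≡ S′ x) →
                    conflict S T ≤ 1 + conflict S′ T
conflict-one-node {S = S} {S′} {T} v same = begin
  conflict S T                              ≤⟨ m≤n+m _ _ ⟩
  clash (S′ v) (T v) + conflict S T         ≤⟨ sum-exchange v (λ x x≢v → ≤-reflexive (cong (λ a → clash a (T x)) (same x x≢v))) ⟩
  clash (S v) (T v) + conflict S′ T         ≤⟨ +-monoˡ-≤ _ (clash≤1 (S v) (T v)) ⟩
  1 + conflict S′ T                         ∎
  where open ≤-Reasoning

mismatch≤conflict : ∀ {m} {S T : Parent m} {r} → RootedAt S r → RootedAt T r →
                    mismatch S T ≤ conflict S T
mismatch≤conflict {S = S} {T} rootedS rootedT =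
  sum-mono (λ x → agree (S x) (T x) (roots-agree rootedS rootedT x) (roots-agree rootedT rootedS x))
  where
  agree : ∀ a b → (a ≡ nothing → b ≡ nothing) → (b ≡ nothing → a ≡ nothing) →
          fails (a ≟ₘ b) ≤ clash a b
  agree nothing  nothing  _ _ = z≤n
  agree nothing  (just _) d _ = case d refl of λ ()
  agree (just _) nothing  _ u = case u refl of λ ()
  agree (just a) (just b) _ _ with a ≟ b
  ... | yes _ = z≤n
  ... | no _  = ≤-refl

_⊑_ : ∀ {m} → Parent m → Parent m → Set
C ⊑ L = ∀ x → C x ≡ L x ⊎ C x ≡ nothing

⊑-permute : ∀ {m} {C L : Parent m} (π : Permutation′ m) → C ⊑ L → permute π C ⊑ permute π L
⊑-permute π C⊑L x with C⊑L (π ⟨$⟩ˡ x)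
... | inj₁ same = inj₁ (cong (map (π ⟨$⟩ʳ_)) same)
... | inj₂ gone = inj₂ (map-nothing gone)

⊑-linkCut-root : ∀ {m} {C L : Parent m} {v} w → C ⊑ L → C v ≡ nothing → C ⊑ linkCut L v w
⊑-linkCut-root {v = v} w C⊑L Cv x with x ≟ v
... | yes refl = inj₂ Cv
... | no _     = C⊑L x

⊑-linkCut-cut : ∀ {m} {C L : Parent m} v w → C ⊑ L → cut C v ⊑ linkCut L v w
⊑-linkCut-cut v w C⊑L x with x ≟ v
... | yes _ = inj₂ refl
... | no _  = C⊑L x

simulate : ∀ {m} {r : Fin m} {L G j} → LCRun r L G j → ∀ {C} → C ⊑ L →
           ∃ λ j′ → ∃ λ G′ → CutRun C G′ j′ × G′ ⊑ G × j′ ≤ j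
simulate done C⊑L = 0 , _ , done , C⊑L , z≤n
simulate (lc u v w _ _ rest) {C} C⊑L with C v in Cv
... | nothing with simulate rest (⊑-linkCut-root w C⊑L Cv)
...   | j′ , G′ , run , G′⊑G , j′≤k = j′ , G′ , run , G′⊑G , m≤n⇒m≤1+n j′≤k
simulate (lc u v w _ _ rest) {C} C⊑L | just u′ with simulate rest (⊑-linkCut-cut v w C⊑L)
...   | j′ , G′ , run , G′⊑G , j′≤k = suc j′ , G′ , ct u′ v Cv run , G′⊑G , s≤s j′≤k
simulate (perm π _ rest) C⊑L with simulate rest (⊑-permute π C⊑L)
... | j′ , G′ , run , G′⊑G , j′≤k =
  support π + j′ , G′ , perm π run , G′⊑G , +-monoʳ-≤ (support π) j′≤k

cuts-from-links : ∀ {m} (r : Fin m) {F₁ F₂ : Parent m} {k} → dAtMost r F₁ F₂ k → d̃AtMost F₁ F₂ k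
cuts-from-links r {F₂ = F₂} (j , G , run , G≐F₂ , j≤k) with simulate run (λ _ → inj₁ refl)
... | j′ , G′ , crun , G′⊑G , j′≤j = j′ , G′ , crun , G′∼F₂ , ≤-trans j′≤j j≤k
  where
  G′∼F₂ : G′ ∼ F₂
  G′∼F₂ x with G′⊑G x
  ... | inj₁ same = inj₁ (trans same (G≐F₂ x))
  ... | inj₂ gone = inj₂ (inj₁ gone)

-- Moving all permutations to the front of a cut run ending ∼ T: their
-- composite σ and the conflicts left between σ·C and T are paid for by the run.
normalise : ∀ {m} (T : Parent m) {C G j} → CutRun C G j → G ∼ T →
            ∃ λ σ → support σ + conflict (permute σ C) T ≤ j
normalise {m} T {C} done C∼T =
  idₚ , ≤-reflexive (cong₂ _+_ (support-id {m}) (trans (conflict-cong T (permute-id C)) (conflict-∼ C∼T)))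
normalise T {C} (ct {k = k} _ v _ rest) G∼T with normalise T rest G∼T
... | σ , cost≤k = σ , (begin
  support σ + conflict (permute σ C) T                 ≤⟨ +-monoʳ-≤ (support σ) (conflict-one-node (σ ⟨$⟩ʳ v) unchanged) ⟩
  support σ + (1 + conflict (permute σ (cut C v)) T)   ≡⟨ +-suc (support σ) _ ⟩
  suc (support σ + conflict (permute σ (cut C v)) T)   ≤⟨ s≤s cost≤k ⟩
  suc k                                                ∎)
  where
  open ≤-Reasoning
  unchanged : ∀ x → x ≢ σ ⟨$⟩ʳ v → permute σ C x ≡ permute σ (cut C v) x
  unchanged x x≢σv = cong (map (σ ⟨$⟩ʳ_))
    (sym (cut-other C (λ e → x≢σv (trans (sym (inverseʳ σ)) (cong (σ ⟨$⟩ʳ_) e)))))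
normalise T {C} (perm {k = k} π rest) G∼T with normalise T rest G∼T
... | σ , cost≤k = π ∘ₚ σ , (begin
  support (π ∘ₚ σ) + conflict (permute (π ∘ₚ σ) C) T           ≤⟨ +-monoˡ-≤ _ (support-∘ π σ) ⟩
  support π + support σ + conflict (permute (π ∘ₚ σ) C) T      ≡⟨ +-assoc (support π) _ _ ⟩
  support π + (support σ + conflict (permute (π ∘ₚ σ) C) T)    ≡⟨ cong (λ c → support π + (support σ + c)) (conflict-cong T (permute-∘ π σ C)) ⟩
  support π + (support σ + conflict (permute σ (permute π C)) T) ≤⟨ +-monoʳ-≤ (support π) cost≤k ⟩
  support π + k                                                ∎)
  where open ≤-Reasoning

module Repair {m} {T : Parent m} {r : Fin m} (tree : IsTreeRootedAt T r) where

  Settled : Parent m → Fin m → Set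
  Settled S w = ∀ y → Descendant T w y → S y ≡ T y

  settled-path : ∀ {S w} → Settled S w → ∀ k → anc S k w ≡ anc T k w
  settled-path st zero = refl
  settled-path {S} {w} st (suc k) with anc S k w | settled-path st k
  ... | _ | refl with anc T k w in e
  ...   | nothing = refl
  ...   | just y  = st y (k , e)

  -- Relinking v below a settled node w cannot create a cycle.
  settled-not-below : ∀ {S v w} → T v ≡ just w → Settled S w → ¬ Descendant S w v
  settled-not-below Tv st (k , e) =
    acyclic (proj₁ tree) k _ (proj₂ (descendant-parent Tv (k , trans (sym (settled-path st k)) e)))

  lowest-mismatch : ∀ {S} → (∀ x → T x ≡ nothing → S x ≡ nothing) →
                    ∀ f x → anc T f x ≡ nothing → S x ≢ T x →
                    ∃ λ v → ∃ λ w → S v ≢ T v × T v ≡ just w × Settled S w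
  lowest-mismatch rootsOk zero x () _
  lowest-mismatch {S} rootsOk (suc f) x gone Sx≢Tx with T x in Tx
  ... | nothing = ⊥-elim (Sx≢Tx (rootsOk x Tx))
  ... | just w with ancestor-search (λ y → S y ≟ₘ T y) f w (parent-fuel f Tx gone)
  ...   | inj₁ settled = x , w , (λ Sx≡Tx → Sx≢Tx (trans Sx≡Tx Tx)) , Tx , settled
  ...   | inj₂ (y , above , Sy≢Ty) =
    lowest-mismatch rootsOk f y (ancestor-fuel f above (parent-fuel f Tx gone)) Sy≢Ty

  improve : ∀ {S} → RootedAt S r → (∃ λ x → S x ≢ T x) →
            ∃ λ v → ∃ λ u → ∃ λ w → S v ≡ just u × ¬ Descendant S w v ×
              RootedAt (linkCut S v w) r × mismatch (linkCut S v w) T < mismatch S T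
  improve {S} rooted (x , Sx≢Tx)
    with lowest-mismatch (roots-agree (proj₂ tree) rooted) m x (proj₁ tree x) Sx≢Tx
  ... | v , w , Sv≢Tv , Tv , settled =
    v , proj₁ parent , w , proj₂ parent , settled-not-below Tv settled ,
    linkCut-rootedAt w rooted v≢r , closer
    where
    v≢r : v ≢ r
    v≢r refl = case trans (sym Tv) (proj₁ (proj₂ tree)) of λ ()
    parent : ∃ λ u → S v ≡ just u
    parent = non-root-parent rooted v≢r
    S′ : Parent m
    S′ = linkCut S v w
    -- v is fixed, every other node is unchanged.
    closer : mismatch S′ T < mismatch S T
    closer = begin
      1 + mismatch S′ T                    ≡⟨ cong (_+ mismatch S′ T) (fails-false Sv≢Tv (S v ≟ₘ T v)) ⟨
      fails (S v ≟ₘ T v) + mismatch S′ T   ≤⟨ sum-exchange v (λ y y≢v → ≤-reflexive (cong (λ a → fails (a ≟ₘ T y)) (linkCut-other S y≢v))) ⟩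
      fails (S′ v ≟ₘ T v) + mismatch S T   ≡⟨ cong (_+ mismatch S T) (fails-true (trans (linkCut-self S v w) (sym Tv)) (S′ v ≟ₘ T v)) ⟩
      mismatch S T                         ∎
      where open ≤-Reasoning

  repair : ∀ c {S} → RootedAt S r → mismatch S T ≤ c → dAtMost r S T c
  repair c {S} rooted bound with all? (λ x → S x ≟ₘ T x)
  ... | yes S≐T = 0 , S , done , S≐T , z≤n
  ... | no S≉T with improve rooted (¬∀⟶∃¬ m _ (λ x → S x ≟ₘ T x) S≉T)
  repair zero    rooted bound | no _ | _ , _ , _ , _ , _ , _ , closer =
    case ≤-trans closer bound of λ ()
  repair (suc c) rooted bound | no _ | v , u , w , Sv , fresh , rooted′ , closer
    with repair c rooted′ (≤-pred (≤-trans closer bound))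
  ... | j , G , run , G≐T , j≤c = suc j , G , lc u v w Sv fresh run , G≐T , s≤s j≤c

prepend-perm : ∀ {m} {r : Fin m} {S T : Parent m} {c} (σ : Permutation′ m) → σ ⟨$⟩ʳ r ≡ r →
               dAtMost r (permute σ S) T c → dAtMost r S T (support σ + c)
prepend-perm σ fix (j , G , run , G≐T , j≤c) =
  support σ + j , G , perm σ fix run , G≐T , +-monoʳ-≤ (support σ) j≤c

dAtMost-weaken : ∀ {m} {r : Fin m} {S T : Parent m} {c c′} → c ≤ c′ →
                 dAtMost r S T c → dAtMost r S T c′
dAtMost-weaken c≤c′ (j , G , run , G≐T , j≤c) = j , G , run , G≐T , ≤-trans j≤c c≤c′

-- Anchored trees differ at most on their n non-anchored nodes.
anchored-mismatch : ∀ {n r} {T₁ T₂ : Parent (n + n)} → Anchored n T₁ r → Anchored n T₂ r →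
                    mismatch T₁ T₂ ≤ n
anchored-mismatch {n} {T₁ = T₁} {T₂} (_ , leaves₁) (_ , leaves₂) =
  sum-bound-first n (λ x → fails≤1 _) (λ x n≤x → fails-true (same x n≤x) _)
  where
  same : ∀ x → n ≤ toℕ x → T₁ x ≡ T₂ x
  same x n≤x = trans (proj₂ (leaves₁ x n≤x)) (sym (proj₂ (leaves₂ x n≤x)))

-- If σ moves the root, each anchored leaf is moved by σ or hangs below σ r ≠ r.
displaced-root-cost : ∀ {n r} {T₁ T₂ : Parent (n + n)} (σ : Permutation′ (n + n)) →
                      Anchored n T₁ r → Anchored n T₂ r → σ ⟨$⟩ʳ r ≢ r →
                      n ≤ support σ + conflict (permute σ T₁) T₂
displaced-root-cost {n} {r} {T₁} {T₂} σ (_ , leaves₁) (_ , leaves₂) σr≢r = begin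
  n                                                         ≤⟨ sum-bound-last n charged ⟩
  sum (λ x → fails ((σ ⟨$⟩ʳ x) ≟ x) + clash (permute σ T₁ x) (T₂ x))
                                                            ≡⟨ ∑-distrib-+ (λ x → fails ((σ ⟨$⟩ʳ x) ≟ x)) (λ x → clash (permute σ T₁ x) (T₂ x)) ⟩
  sum (λ x → fails ((σ ⟨$⟩ʳ x) ≟ x)) + conflict (permute σ T₁) T₂
                                                            ≡⟨ cong (_+ conflict (permute σ T₁) T₂) (support-sum σ) ⟨
  support σ + conflict (permute σ T₁) T₂                    ∎
  where
  open ≤-Reasoning
  charged : ∀ x → n ≤ toℕ x → 1 ≤ fails ((σ ⟨$⟩ʳ x) ≟ x) + clash (permute σ T₁ x) (T₂ x)
  charged x n≤x with (σ ⟨$⟩ʳ x) ≟ x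
  ... | no _     = s≤s z≤n
  ... | yes σx≡x = ≤-reflexive (sym (trans (cong₂ clash below-σr (proj₂ (leaves₂ x n≤x))) (fails-false σr≢r _)))
    where
    below-σr : permute σ T₁ x ≡ just (σ ⟨$⟩ʳ r)
    below-σr = cong (map (σ ⟨$⟩ʳ_))
      (trans (cong T₁ (trans (cong (σ ⟨$⟩ˡ_) (sym σx≡x)) (inverseˡ σ))) (proj₂ (leaves₁ x n≤x)))

lemma9 : (n : ℕ) (r : Fin (n + n)) (T₁ T₂ : Parent (n + n)) →
    Anchored n T₁ r → Anchored n T₂ r →
    (k : ℕ) → d̃AtMost T₁ T₂ k ⇔ dAtMost r T₁ T₂ k
lemma9 n r T₁ T₂ anchored₁ anchored₂ k = mk⇔ links-from-cuts (cuts-from-links r)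
  where
  open Repair (proj₁ anchored₂)
  rooted₁ : RootedAt T₁ r
  rooted₁ = proj₂ (proj₁ anchored₁)
  rooted₂ : RootedAt T₂ r
  rooted₂ = proj₂ (proj₁ anchored₂)

  links-from-cuts : d̃AtMost T₁ T₂ k → dAtMost r T₁ T₂ k
  links-from-cuts (j , G , run , G∼T₂ , j≤k) with normalise T₂ run G∼T₂
  ... | σ , cost≤j with (σ ⟨$⟩ʳ r) ≟ r
  ...   | yes σr≡r = dAtMost-weaken (≤-trans cost≤j j≤k)
                       (prepend-perm σ σr≡r (repair _ rootedσ (mismatch≤conflict rootedσ rooted₂)))
    where
    rootedσ : RootedAt (permute σ T₁) r
    rootedσ = subst (RootedAt (permute σ T₁)) σr≡r (permute-rootedAt σ rooted₁)
  ...   | no σr≢r = repair k rooted₁ (begin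
    mismatch T₁ T₂                             ≤⟨ anchored-mismatch anchored₁ anchored₂ ⟩
    n                                          ≤⟨ displaced-root-cost σ anchored₁ anchored₂ σr≢r ⟩
    support σ + conflict (permute σ T₁) T₂     ≤⟨ ≤-trans cost≤j j≤k ⟩
    k                                          ∎)
    where open ≤-Reasoning
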